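{- Let $r, d$ be positive integers. Then there exist $\eta(r,d) > 0$ and $n_0(r,d)$ such that the following holds. If $n \geq n_0(r,d)$, $\eta \in [0, \eta(r,d)]$, and $c : \tilde X \to [r]$ is a $(1-\eta)$-almost $r$-colouring of $\mathbb{F}_2^n$, then there are linearly independent $x_1, \dots, x_d \in \mathbb{F}_2^n$ such that all of the sums $\sum_{i\in I} x_i$, for nonempty $I \subset [d]$, lie in $\tilde X$ and have the same colour under $c$.
   Context: $[r] = \{1,\dots,r\}$. A $(1-\delta)$-almost $r$-colouring of a finite set $X$ is a map $c : \tilde X \to [r]$ defined on a subset $\tilde X \subset X$ with $|X \setminus \tilde X| \leq \delta |X|$.
   Formalization: The tolerance η ranges over the rationals, and the threshold η(r,d) is likewise taken in the rationals. -}

module Defs where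

open import Data.Nat using (ℕ; zero; suc; _+_)
open import Data.Bool using (Bool; true; false; _xor_; if_then_else_)
open import Data.Vec using (Vec; []; _∷_; replicate; zipWith; map)
open import Data.List using (List; []; _∷_; _++_)
import Data.List as L
open import Data.Maybe using (Maybe; just; nothing)
open import Data.Fin using (Fin)
open import Data.Integer using (+_)
open import Data.Rational using (ℚ; _/_; _≤_; _<_; _*_; 0ℚ)
open import Data.Nat using (_^_)
open import Relation.Binary.PropositionalEquality using (_≡_)

-- The vector space 𝔽₂ⁿ, with 𝔽₂ = Bool (false = 0, true = 1, addition = xor).
F2^ : ℕ → Set
F2^ n = Vec Bool n

zeroV : ∀ {n} → F2^ n
zeroV = replicate _ false

_⊕_ : ∀ {n} → F2^ n → F2^ n → F2^ n
_⊕_ = zipWith _xor_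

-- Linear combination Σᵢ aᵢ xᵢ over 𝔽₂ (equivalently the sum Σ_{i ∈ I} xᵢ
-- where I ⊆ [d] is given by its characteristic vector a).
linComb : ∀ {n d} → Vec Bool d → Vec (F2^ n) d → F2^ n
linComb [] [] = zeroV
linComb (a ∷ as) (x ∷ xs) = if a then x ⊕ linComb as xs else linComb as xs

LinIndep : ∀ {n d} → Vec (F2^ n) d → Set
LinIndep {n} {d} xs = (a : Vec Bool d) → linComb a xs ≡ zeroV → a ≡ replicate d false

allVecs : (n : ℕ) → List (F2^ n)
allVecs zero = [] ∷ []
allVecs (suc n) = L.map (false ∷_) (allVecs n) ++ L.map (true ∷_) (allVecs n)

-- A partial colouring c : 𝔽₂ⁿ → Maybe (Fin r) encodes c : X̃ → [r] with
-- X̃ = { x | c x ≢ nothing }.  Number of uncoloured points |X \ X̃|: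
countNothing : ∀ {A B : Set} → (A → Maybe B) → List A → ℕ
countNothing c [] = 0
countNothing c (x ∷ xs) with c x
... | nothing = suc (countNothing c xs)
... | just _  = countNothing c xs

ℕtoℚ : ℕ → ℚ
ℕtoℚ k = (+ k) / 1

AlmostColouring : (n r : ℕ) → ℚ → (F2^ n → Maybe (Fin r)) → Set
AlmostColouring n r η c = ℕtoℚ (countNothing c (allVecs n)) ≤ η * ℕtoℚ (2 ^ n)

module Submission where

-- (1) Affine cube lemma.  For every finite colour set and every K there is M
--     such that every colouring of 𝔽₂^M is constant on some affine cube
--     b + ⟨w₁,…,w_K⟩ with independent wᵢ.  Induction on K: 𝔽₂^{L+M'} is split
--     into 2^L slices {x} × 𝔽₂^{M'}; with L large, two slices x ≠ y are
--     coloured identically (pigeonhole), and a cube inside the slice of x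
--     together with the new direction x + y is a cube of one more dimension.
-- (2) Folkman's theorem in 𝔽₂ᴺ, with a demand for each colour.  If only 0 may
--     be uncoloured, some colour ρ has demand(ρ) vectors all of whose nonempty
--     sums have colour ρ.  Induction on the total demand: a cube b + ⟨w, ws⟩
--     has a nonzero point, hence a colour κ; b is one more vector of colour κ
--     and the reduced demand is met inside ⟨ws⟩ ≅ 𝔽₂ᴺ.
-- (3) Embedding lemma.  If |U| 2ᴺ < 2ⁿ, a greedy choice gives u₁,…,u_N whose
--     only combination in U is the trivial one.
--
-- The theorem: make 0 uncoloured; an almost colouring with η ≤ 1/(1+2^(1+N))
-- leaves few uncoloured points, so (3) embeds 𝔽₂ᴺ avoiding them; (2) with all
-- demands d gives the family, and the family is independent because all its
-- nonempty sums are coloured while 0 is not.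

module Ramsey where

  open import Defs
  open import Data.Nat
    using (ℕ; zero; suc; pred; _+_; _*_; _^_; _<_; _≤_; s≤s; z≤n; s≤s⁻¹; +-0-rawMonoid)
  import Data.Nat.Properties as ℕP
  open import Data.Nat.Tactic.RingSolver using (solve-∀)
  open import Algebra.Definitions.RawMonoid +-0-rawMonoid using (sum)
  open import Data.Bool using (Bool; true; false; _xor_; if_then_else_)
  import Data.Bool as Bool
  open import Data.Bool.Properties using (xor-comm; xor-assoc; xor-identityˡ; xor-identityʳ; xor-same)
  open import Data.Vec using (Vec; []; _∷_; _++_; map)
  import Data.Vec.Base as V
  open import Data.Vec.Properties
    using (≡-dec; zipWith-comm; zipWith-assoc; zipWith-identityˡ; zipWith-identityʳ; zipWith-++;
           ++-injectiveˡ; ++-injectiveʳ; ∷-injectiveˡ; ∷-injectiveʳ)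
  open import Data.Vec.Recursive using (Fin[m^n]↔Fin[m]^n; lift↔)
  open import Data.Vec.Recursive.Properties using (↔Vec)
  open import Data.Vec.Functional using (updateAt)
  open import Data.Vec.Functional.Properties using (updateAt-updates; updateAt-minimal)
  open import Data.Fin using (Fin; zero; suc; _≟_; finToFun; funToFin)
  open import Data.Fin.Properties
    using (2↔Bool; finToFun-funToFin; pigeonhole; <⇒≢; suc-injective;
           all?; ¬∀⟶∃¬; injective⇒≤)
  open import Data.Fin.Subset using (Subset; Nonempty)
  open import Data.Fin.Subset.Properties using (nonempty?; Empty-unique)
  open import Data.Maybe using (Maybe; just; nothing; maybe)
  open import Data.List using (List; []; _∷_; length; tabulate; cartesianProductWith)
  import Data.List as L
  open import Data.List.Properties using (length-tabulate; length-map; length-++)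
  open import Data.List.Membership.Propositional using (_∈_; _∉_)
  open import Data.List.Membership.Propositional.Properties
    using (∈-tabulate⁺; ∈-cartesianProductWith⁺; ∈-map⁺; ∈-++⁺ˡ; ∈-++⁺ʳ)
  open import Data.List.Relation.Unary.Any using (here; there)
  import Data.List.Relation.Unary.Any as Any
  open import Data.List.Relation.Unary.Any.Properties using (lookup-index)
  open import Data.Product using (Σ; _×_; _,_; ∃; proj₁; proj₂)
  open import Data.Empty using (⊥-elim)
  open import Function using (_∘_; _↣_; _↔_; Injection; Inverse; mk↣)
  open import Function.Properties.Inverse using (↔-trans)
  open import Relation.Nullary using (¬_; Dec; yes; no; contradiction)
  open import Relation.Binary.PropositionalEquality
  open ≡-Reasoning

  private
    variable
      n m k : ℕ

  ⊕-comm : (x y : F2^ n) → x ⊕ y ≡ y ⊕ x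
  ⊕-comm = zipWith-comm xor-comm

  ⊕-assoc : (x y z : F2^ n) → (x ⊕ y) ⊕ z ≡ x ⊕ (y ⊕ z)
  ⊕-assoc = zipWith-assoc xor-assoc

  ⊕-identityˡ : (x : F2^ n) → zeroV ⊕ x ≡ x
  ⊕-identityˡ = zipWith-identityˡ xor-identityˡ

  ⊕-identityʳ : (x : F2^ n) → x ⊕ zeroV ≡ x
  ⊕-identityʳ = zipWith-identityʳ xor-identityʳ

  ⊕-self : (x : F2^ n) → x ⊕ x ≡ zeroV
  ⊕-self []      = refl
  ⊕-self (a ∷ x) = cong₂ _∷_ (xor-same a) (⊕-self x)

  ⊕-cancelˡ : (x y : F2^ n) → x ⊕ (x ⊕ y) ≡ y
  ⊕-cancelˡ x y = begin
    x ⊕ (x ⊕ y)  ≡⟨ ⊕-assoc x x y ⟨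
    (x ⊕ x) ⊕ y  ≡⟨ cong (_⊕ y) (⊕-self x) ⟩
    zeroV ⊕ y    ≡⟨ ⊕-identityˡ y ⟩
    y            ∎

  ⊕-cancelʳ : (x y : F2^ n) → (x ⊕ y) ⊕ y ≡ x
  ⊕-cancelʳ x y = begin
    (x ⊕ y) ⊕ y  ≡⟨ ⊕-assoc x y y ⟩
    x ⊕ (y ⊕ y)  ≡⟨ cong (x ⊕_) (⊕-self y) ⟩
    x ⊕ zeroV    ≡⟨ ⊕-identityʳ x ⟩
    x            ∎

  ⊕≡zero⇒≡ : (x y : F2^ n) → x ⊕ y ≡ zeroV → x ≡ y
  ⊕≡zero⇒≡ x y x⊕y≡0 = begin
    x            ≡⟨ ⊕-cancelʳ x y ⟨
    (x ⊕ y) ⊕ y  ≡⟨ cong (_⊕ y) x⊕y≡0 ⟩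
    zeroV ⊕ y    ≡⟨ ⊕-identityˡ y ⟩
    y            ∎

  ⊕-swapˡ : (x y z : F2^ n) → x ⊕ (y ⊕ z) ≡ y ⊕ (x ⊕ z)
  ⊕-swapˡ x y z = begin
    x ⊕ (y ⊕ z)  ≡⟨ ⊕-assoc x y z ⟨
    (x ⊕ y) ⊕ z  ≡⟨ cong (_⊕ z) (⊕-comm x y) ⟩
    (y ⊕ x) ⊕ z  ≡⟨ ⊕-assoc y x z ⟩
    y ⊕ (x ⊕ z)  ∎

  ⊕-++ : (x : F2^ m) (y : F2^ n) (x′ : F2^ m) (y′ : F2^ n) →
         (x ++ y) ⊕ (x′ ++ y′) ≡ (x ⊕ x′) ++ (y ⊕ y′)
  ⊕-++ = zipWith-++ _xor_

  zeroV-++ : ∀ m → zeroV {m + n} ≡ zeroV {m} ++ zeroV {n}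
  zeroV-++ zero    = refl
  zeroV-++ (suc m) = cong (false ∷_) (zeroV-++ m)

  linMap : Vec (F2^ n) k → F2^ k → F2^ n
  linMap us a = linComb a us

  linMap-zero : (us : Vec (F2^ n) k) → linMap us zeroV ≡ zeroV
  linMap-zero []       = refl
  linMap-zero (u ∷ us) = linMap-zero us

  linMap-⊕ : (us : Vec (F2^ n) k) (a b : F2^ k) →
             linMap us (a ⊕ b) ≡ linMap us a ⊕ linMap us b
  linMap-⊕ []       []          []          = sym (⊕-identityʳ zeroV)
  linMap-⊕ (u ∷ us) (false ∷ a) (false ∷ b) = linMap-⊕ us a b
  linMap-⊕ (u ∷ us) (false ∷ a) (true ∷ b)  = begin
    u ⊕ linMap us (a ⊕ b)              ≡⟨ cong (u ⊕_) (linMap-⊕ us a b) ⟩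
    u ⊕ (linMap us a ⊕ linMap us b)    ≡⟨ ⊕-swapˡ u _ _ ⟩
    linMap us a ⊕ (u ⊕ linMap us b)    ∎
  linMap-⊕ (u ∷ us) (true ∷ a)  (false ∷ b) = begin
    u ⊕ linMap us (a ⊕ b)              ≡⟨ cong (u ⊕_) (linMap-⊕ us a b) ⟩
    u ⊕ (linMap us a ⊕ linMap us b)    ≡⟨ ⊕-assoc u _ _ ⟨
    (u ⊕ linMap us a) ⊕ linMap us b    ∎
  linMap-⊕ (u ∷ us) (true ∷ a)  (true ∷ b)  = begin
    linMap us (a ⊕ b)                        ≡⟨ linMap-⊕ us a b ⟩
    linMap us a ⊕ linMap us b                ≡⟨ ⊕-cancelˡ u _ ⟨
    u ⊕ (u ⊕ (linMap us a ⊕ linMap us b))    ≡⟨ cong (u ⊕_) (⊕-swapˡ u _ _) ⟩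
    u ⊕ (linMap us a ⊕ (u ⊕ linMap us b))    ≡⟨ ⊕-assoc u _ _ ⟨
    (u ⊕ linMap us a) ⊕ (u ⊕ linMap us b)    ∎

  linComb-map : (us : Vec (F2^ n) m) (I : F2^ k) (xs : Vec (F2^ m) k) →
                linComb I (map (linMap us) xs) ≡ linMap us (linComb I xs)
  linComb-map us []          []       = sym (linMap-zero us)
  linComb-map us (false ∷ I) (x ∷ xs) = linComb-map us I xs
  linComb-map us (true ∷ I)  (x ∷ xs) = begin
    linMap us x ⊕ linComb I (map (linMap us) xs)  ≡⟨ cong (linMap us x ⊕_) (linComb-map us I xs) ⟩
    linMap us x ⊕ linMap us (linComb I xs)        ≡⟨ linMap-⊕ us x (linComb I xs) ⟨
    linMap us (x ⊕ linComb I xs)                  ∎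

  LinIndep-tail : {x : F2^ n} {xs : Vec (F2^ n) k} → LinIndep (x ∷ xs) → LinIndep xs
  LinIndep-tail indep a a·xs≡0 = ∷-injectiveʳ (indep (false ∷ a) a·xs≡0)

  enumeration : ∀ n → Fin (2 ^ n) ↔ F2^ n
  enumeration n = ↔-trans (Fin[m^n]↔Fin[m]^n 2 n) (↔-trans (lift↔ n 2↔Bool) (↔Vec n))

  enum : ∀ n → Fin (2 ^ n) → F2^ n
  enum n = Inverse.to (enumeration n)

  rank : ∀ n → F2^ n → Fin (2 ^ n)
  rank n = Inverse.from (enumeration n)

  enum-rank : ∀ n (v : F2^ n) → enum n (rank n v) ≡ v
  enum-rank n = Inverse.strictlyInverseˡ (enumeration n)

  enum-injective : ∀ n {i j : Fin (2 ^ n)} → enum n i ≡ enum n j → i ≡ j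
  enum-injective n {i} {j} eq = begin
    i                  ≡⟨ Inverse.strictlyInverseʳ (enumeration n) i ⟨
    rank n (enum n i)  ≡⟨ cong (rank n) eq ⟩
    rank n (enum n j)  ≡⟨ Inverse.strictlyInverseʳ (enumeration n) j ⟩
    j                  ∎

  -- Needed to make 𝔽₂^L outnumber a set of size L.
  n<2^n : ∀ n → n < 2 ^ n
  n<2^n zero    = s≤s z≤n
  n<2^n (suc n) = subst (suc n <_) (cong (2 ^ n +_) (sym (ℕP.+-identityʳ (2 ^ n))))
                        (ℕP.+-mono-≤-< (ℕP.m^n>0 2 n) (n<2^n n))

  record MonochromaticCube {C : Set} {M : ℕ} (χ : F2^ M → C) (K : ℕ) : Set where
    field
      base          : F2^ M
      dirs          : Vec (F2^ M) K
      independent   : LinIndep dirs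
      monochromatic : ∀ a → χ (base ⊕ linMap dirs a) ≡ χ base

  -- Pigeonhole on slices: 𝔽₂^L with L = R^(2^M) has more points than there are
  -- R-colourings of 𝔽₂^M, so two distinct slices {x} × 𝔽₂^M are coloured alike.
  twin-slices : {C : Set} {R M : ℕ} → C ↣ Fin R → (χ : F2^ (R ^ 2 ^ M + M) → C) →
    Σ (F2^ (R ^ 2 ^ M)) λ x → Σ (F2^ (R ^ 2 ^ M)) λ y →
      x ≢ y × (∀ v → χ (x ++ v) ≡ χ (y ++ v))
  twin-slices {R = R} {M} enc χ = from-collision (pigeonhole (n<2^n L) sliceCode)
    where
    L = R ^ 2 ^ M
    sliceColouring : F2^ L → Fin (2 ^ M) → Fin R
    sliceColouring x j = Injection.to enc (χ (x ++ enum M j))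
    sliceCode : Fin (2 ^ L) → Fin L
    sliceCode i = funToFin (sliceColouring (enum L i))
    from-collision : ∃ (λ i → ∃ λ j → i Data.Fin.< j × sliceCode i ≡ sliceCode j) →
      Σ (F2^ L) λ x → Σ (F2^ L) λ y → x ≢ y × (∀ v → χ (x ++ v) ≡ χ (y ++ v))
    from-collision (i , j , i<j , sameCode) = x , y , <⇒≢ i<j ∘ enum-injective L , agree
      where
      x = enum L i
      y = enum L j
      sameColouring : ∀ k → sliceColouring x k ≡ sliceColouring y k
      sameColouring k = begin
        sliceColouring x k                        ≡⟨ finToFun-funToFin (sliceColouring x) k ⟨
        finToFun (sliceCode i) k                  ≡⟨ cong (λ code → finToFun code k) sameCode ⟩
        finToFun (sliceCode j) k                  ≡⟨ finToFun-funToFin (sliceColouring y) k ⟩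
        sliceColouring y k                        ∎
      agree : ∀ v → χ (x ++ v) ≡ χ (y ++ v)
      agree v = begin
        χ (x ++ v)                  ≡⟨ cong (λ w → χ (x ++ w)) (enum-rank M v) ⟨
        χ (x ++ enum M (rank M v))  ≡⟨ Injection.injective enc (sameColouring (rank M v)) ⟩
        χ (y ++ enum M (rank M v))  ≡⟨ cong (λ w → χ (y ++ w)) (enum-rank M v) ⟩
        χ (y ++ v)                  ∎

  linMap-padˡ : (ws : Vec (F2^ m) k) (a : F2^ k) →
                linMap (map (zeroV {n} ++_) ws) a ≡ zeroV ++ linMap ws a
  linMap-padˡ {n = n} [] [] = zeroV-++ n
  linMap-padˡ (w ∷ ws) (false ∷ a) = linMap-padˡ ws a
  linMap-padˡ {n = n} (w ∷ ws) (true ∷ a) = begin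
    (zeroV ++ w) ⊕ linMap (map (zeroV ++_) ws) a  ≡⟨ cong ((zeroV ++ w) ⊕_) (linMap-padˡ ws a) ⟩
    (zeroV ++ w) ⊕ (zeroV ++ linMap ws a)         ≡⟨ ⊕-++ zeroV w zeroV (linMap ws a) ⟩
    (zeroV ⊕ zeroV) ++ (w ⊕ linMap ws a)          ≡⟨ cong (_++ _) (⊕-self (zeroV {n})) ⟩
    zeroV ++ (w ⊕ linMap ws a)                    ∎

  extendDirs : F2^ n → Vec (F2^ m) k → Vec (F2^ (n + m)) (suc k)
  extendDirs w ws = (w ++ zeroV) ∷ map (zeroV ++_) ws

  linMap-extendDirs : (w : F2^ n) (ws : Vec (F2^ m) k) (c : Bool) (a : F2^ k) →
    linMap (extendDirs w ws) (c ∷ a) ≡ (if c then w else zeroV) ++ linMap ws a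
  linMap-extendDirs w ws false a = linMap-padˡ ws a
  linMap-extendDirs w ws true  a = begin
    (w ++ zeroV) ⊕ linMap (map (zeroV ++_) ws) a  ≡⟨ cong ((w ++ zeroV) ⊕_) (linMap-padˡ ws a) ⟩
    (w ++ zeroV) ⊕ (zeroV ++ linMap ws a)         ≡⟨ ⊕-++ w zeroV zeroV (linMap ws a) ⟩
    (w ⊕ zeroV) ++ (zeroV ⊕ linMap ws a)          ≡⟨ cong₂ _++_ (⊕-identityʳ w) (⊕-identityˡ _) ⟩
    w ++ linMap ws a                              ∎

  extendDirs-vanishing : (w : F2^ n) (ws : Vec (F2^ m) k) (c : Bool) (a : F2^ k) →
    linMap (extendDirs w ws) (c ∷ a) ≡ zeroV →
    (if c then w else zeroV) ≡ zeroV × linMap ws a ≡ zeroV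
  extendDirs-vanishing {n = n} {m = m} w ws c a combination≡0 =
    ++-injectiveˡ _ zeroV blocks≡0 , ++-injectiveʳ _ zeroV blocks≡0
    where
    blocks≡0 : (if c then w else zeroV) ++ linMap ws a ≡ zeroV {n} ++ zeroV {m}
    blocks≡0 = trans (sym (linMap-extendDirs w ws c a)) (trans combination≡0 (zeroV-++ n))

  extendDirs-independent : (w : F2^ n) (ws : Vec (F2^ m) k) →
    w ≢ zeroV → LinIndep ws → LinIndep (extendDirs w ws)
  extendDirs-independent w ws w≢0 indep (false ∷ a) combination≡0 =
    cong (false ∷_) (indep a (proj₂ (extendDirs-vanishing w ws false a combination≡0)))
  extendDirs-independent w ws w≢0 indep (true ∷ a) combination≡0 =
    ⊥-elim (w≢0 (proj₁ (extendDirs-vanishing w ws true a combination≡0)))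

  cube-lemma : {C : Set} {R : ℕ} → C ↣ Fin R → ∀ K →
    Σ ℕ λ M → (χ : F2^ M → C) → MonochromaticCube χ K
  cube-lemma enc zero = 0 , λ χ → record
    { base = [] ; dirs = [] ; independent = λ { [] _ → refl } ; monochromatic = λ { [] → refl } }
  cube-lemma {R = R} enc (suc K) with cube-lemma enc K
  ... | M , sliceCube = R ^ 2 ^ M + M , cube
    where
    cube : (χ : F2^ (R ^ 2 ^ M + M) → _) → MonochromaticCube χ (suc K)
    cube χ with twin-slices {M = M} enc χ
    ... | x , y , x≢y , agree = record
      { base          = x ++ base
      ; dirs          = extendDirs (x ⊕ y) dirs
      ; independent   = extendDirs-independent (x ⊕ y) dirs (x≢y ∘ ⊕≡zero⇒≡ x y) independent
      ; monochromatic = cubeColour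
      }
      where
      open MonochromaticCube (sliceCube (λ v → χ (x ++ v)))
      point : ∀ c a → (x ++ base) ⊕ linMap (extendDirs (x ⊕ y) dirs) (c ∷ a)
                      ≡ (if c then y else x) ++ (base ⊕ linMap dirs a)
      point c a = begin
        (x ++ base) ⊕ linMap (extendDirs (x ⊕ y) dirs) (c ∷ a)
          ≡⟨ cong ((x ++ base) ⊕_) (linMap-extendDirs (x ⊕ y) dirs c a) ⟩
        (x ++ base) ⊕ ((if c then x ⊕ y else zeroV) ++ linMap dirs a)
          ≡⟨ ⊕-++ x base _ (linMap dirs a) ⟩
        (x ⊕ (if c then x ⊕ y else zeroV)) ++ (base ⊕ linMap dirs a)
          ≡⟨ cong (_++ (base ⊕ linMap dirs a)) (shift c) ⟩
        (if c then y else x) ++ (base ⊕ linMap dirs a)  ∎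
        where
        shift : ∀ c → x ⊕ (if c then x ⊕ y else zeroV) ≡ (if c then y else x)
        shift false = ⊕-identityʳ x
        shift true  = ⊕-cancelˡ x y
      cubeColour : ∀ a → χ ((x ++ base) ⊕ linMap (extendDirs (x ⊕ y) dirs) a) ≡ χ (x ++ base)
      cubeColour (false ∷ a) = trans (cong χ (point false a)) (monochromatic a)
      cubeColour (true ∷ a)  = begin
        χ ((x ++ base) ⊕ linMap (extendDirs (x ⊕ y) dirs) (true ∷ a))
          ≡⟨ cong χ (point true a) ⟩
        χ (y ++ (base ⊕ linMap dirs a))
          ≡⟨ agree _ ⟨
        χ (x ++ (base ⊕ linMap dirs a))
          ≡⟨ monochromatic a ⟩
        χ (x ++ base)  ∎

  ColouredOffZero : {C : Set} → (F2^ n → Maybe C) → Set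
  ColouredOffZero χ = ∀ v → χ v ≡ nothing → v ≡ zeroV

  MonochromaticSums : {C : Set} → (F2^ n → Maybe C) → C → Vec (F2^ n) k → Set
  MonochromaticSums {k = k} χ ρ xs = (I : Subset k) → Nonempty I → χ (linComb I xs) ≡ just ρ

  SumFamily : {C : Set} → (F2^ n → Maybe C) → C → ℕ → Set
  SumFamily {n = n} χ ρ m = Σ (Vec (F2^ n) m) (MonochromaticSums χ ρ)

  emptyFamily : {C : Set} {χ : F2^ n → Maybe C} {ρ : C} → SumFamily χ ρ 0
  emptyFamily = [] , λ { [] (() , _) }

  Nonempty-tail : {J : Subset k} → Nonempty (false ∷ J) → Nonempty J
  Nonempty-tail (suc i , V.there i∈J) = i , i∈J

  map-family : {C : Set} (χ : F2^ n → Maybe C) {ρ : C} (us : Vec (F2^ n) m) (xs : Vec (F2^ m) k) →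
    MonochromaticSums (χ ∘ linMap us) ρ xs → MonochromaticSums χ ρ (map (linMap us) xs)
  map-family χ us xs mono I I≢∅ = trans (cong χ (linComb-map us I xs)) (mono I I≢∅)

  cons-family : {C : Set} (χ : F2^ n → Maybe C) {ρ : C} (b : F2^ n) (us : Vec (F2^ n) m)
    (ys : Vec (F2^ m) k) → (∀ a → χ (b ⊕ linMap us a) ≡ just ρ) →
    MonochromaticSums (χ ∘ linMap us) ρ ys → MonochromaticSums χ ρ (b ∷ map (linMap us) ys)
  cons-family χ b us ys translate mono (true ∷ J) _ =
    trans (cong (λ z → χ (b ⊕ z)) (linComb-map us J ys)) (translate (linComb J ys))
  cons-family χ b us ys translate mono (false ∷ J) J≢∅ =
    map-family χ us ys mono J (Nonempty-tail J≢∅)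

  pullback-offZero : {C : Set} {χ : F2^ n → Maybe C} {us : Vec (F2^ n) k} →
    LinIndep us → ColouredOffZero χ → ColouredOffZero (χ ∘ linMap us)
  pullback-offZero indep off v uncoloured = indep v (off _ uncoloured)

  -- A cube of positive dimension has a nonzero point, so it is coloured.
  cube-coloured : {C : Set} {χ : F2^ n → Maybe C} → ColouredOffZero χ →
    (cube : MonochromaticCube χ (suc k)) → Σ C λ κ → χ (MonochromaticCube.base cube) ≡ just κ
  cube-coloured {χ = χ} off cube with χ (MonochromaticCube.base cube) in colour
  ... | just κ  = κ , refl
  ... | nothing = ⊥-elim (true≢false (∷-injectiveˡ (independent (true ∷ zeroV) p≡0)))
    where
    open MonochromaticCube cube
    -- base and base + p are both uncoloured, hence both 0, so p = 0
    p = linMap dirs (true ∷ zeroV)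
    b≡0 : base ≡ zeroV
    b≡0 = off base colour
    b≡p : base ≡ p
    b≡p = ⊕≡zero⇒≡ base p (off _ (trans (monochromatic (true ∷ zeroV)) colour))
    p≡0 : p ≡ zeroV
    p≡0 = trans (sym b≡p) b≡0
    true≢false : ¬ (true ≡ false)
    true≢false ()

  -- Uncoloured points as an extra colour: Maybe (Fin R) embeds in Fin (suc R).
  maybeFin↣ : ∀ {R} → Maybe (Fin R) ↣ Fin (suc R)
  maybeFin↣ = mk↣ {to = maybe suc zero} injective
    where
    injective : ∀ {s t} → maybe suc zero s ≡ maybe suc zero t → s ≡ t
    injective {just s}  {just t}  eq   = cong just (suc-injective eq)
    injective {nothing} {nothing} refl = refl
    injective {just _}  {nothing} ()
    injective {nothing} {just _}  ()

  sum-decrement : ∀ {R} (demand : Fin R → ℕ) (κ : Fin R) → demand κ ≡ suc k →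
    sum demand ≡ suc (sum (updateAt demand κ pred))
  sum-decrement demand zero    dκ rewrite dκ = refl
  sum-decrement demand (suc κ) dκ =
    trans (cong (demand zero +_) (sum-decrement (demand ∘ suc) κ dκ)) (ℕP.+-suc (demand zero) _)

  FolkmanProperty : (R T N : ℕ) → Set
  FolkmanProperty R T N = (demand : Fin (suc R) → ℕ) → sum demand ≤ T →
    (χ : F2^ N → Maybe (Fin (suc R))) → ColouredOffZero χ →
    Σ (Fin (suc R)) λ ρ → SumFamily χ ρ (demand ρ)

  -- One round: the translate b + ⟨ws⟩ has colour κ; meet the demand for κ
  -- reduced by one inside ⟨ws⟩ ≅ 𝔽₂ᴺ, and then add b if κ was the colour found.
  grow-family : ∀ {R T N M} → FolkmanProperty R T N →
    (demand : Fin (suc R) → ℕ) → sum demand ≤ suc T →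
    (χ : F2^ M → Maybe (Fin (suc R))) (b : F2^ M) (ws : Vec (F2^ M) N) →
    ColouredOffZero (χ ∘ linMap ws) →
    (κ : Fin (suc R)) → (∀ a → χ (b ⊕ linMap ws a) ≡ just κ) →
    Σ (Fin (suc R)) λ ρ → SumFamily χ ρ (demand ρ)
  grow-family {T = T} smaller demand total≤ χ b ws off κ translate with demand κ in dκ
  ... | zero  = κ , subst (SumFamily χ κ) (sym dκ) (emptyFamily {χ = χ})
  ... | suc k with smaller (updateAt demand κ pred) lowered (χ ∘ linMap ws) off
    where
    lowered : sum (updateAt demand κ pred) ≤ T
    lowered = s≤s⁻¹ (subst (_≤ suc T) (sum-decrement demand κ dκ) total≤)
  ... | ρ , family with ρ ≟ κ
  ... | yes refl = κ , subst (SumFamily χ κ) (sym dκ) (extendBy-b reducedFamily)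
    where
    reducedFamily : SumFamily (χ ∘ linMap ws) κ k
    reducedFamily = subst (SumFamily (χ ∘ linMap ws) κ)
                          (trans (updateAt-updates κ demand) (cong pred dκ)) family
    extendBy-b : SumFamily (χ ∘ linMap ws) κ k → SumFamily χ κ (suc k)
    extendBy-b (ys , mono) = b ∷ map (linMap ws) ys , cons-family χ b ws ys translate mono
  ... | no ρ≢κ = ρ , subst (SumFamily χ ρ) (updateAt-minimal ρ κ demand ρ≢κ) (push family)
    where
    push : ∀ {m} → SumFamily (χ ∘ linMap ws) ρ m → SumFamily χ ρ m
    push (ys , mono) = map (linMap ws) ys , map-family χ ws ys mono

  folkman : ∀ R T → Σ ℕ (FolkmanProperty R T)
  folkman R zero = 0 , λ demand total≡0 χ _ →
    zero , subst (SumFamily χ zero) (sym (ℕP.m+n≡0⇒m≡0 _ (ℕP.n≤0⇒n≡0 total≡0)))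
                 (emptyFamily {χ = χ})
  folkman R (suc T) with folkman R T
  ... | N , smaller with cube-lemma (maybeFin↣ {suc R}) (suc N)
  ... | M , cubes = M , round
    where
    round : FolkmanProperty R (suc T) M
    round demand total≤ χ off = useCube (cubes χ)
      where
      useCube : MonochromaticCube χ (suc N) → Σ (Fin (suc R)) λ ρ → SumFamily χ ρ (demand ρ)
      useCube cube@record { base = b ; dirs = _ ∷ ws ; independent = indep ; monochromatic = mono } =
        let κ , bκ = cube-coloured off cube in
        grow-family smaller demand total≤ χ b ws (pullback-offZero (LinIndep-tail indep) off)
                    κ (λ a → trans (mono (false ∷ a)) bκ)

  spanList : Vec (F2^ n) k → List (F2^ n)
  spanList {k = k} us = tabulate (linMap us ∘ enum k)

  length-spanList : (us : Vec (F2^ n) k) → length (spanList us) ≡ 2 ^ k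
  length-spanList us = length-tabulate _

  ∈-spanList : (us : Vec (F2^ n) k) (a : F2^ k) → linMap us a ∈ spanList us
  ∈-spanList {k = k} us a =
    subst (_∈ spanList us) (cong (linMap us) (enum-rank k a)) (∈-tabulate⁺ (rank k a))

  length-cartesianProductWith : {A B C : Set} (f : A → B → C) (xs : List A) (ys : List B) →
    length (cartesianProductWith f xs ys) ≡ length xs * length ys
  length-cartesianProductWith f []       ys = refl
  length-cartesianProductWith f (x ∷ xs) ys = begin
    length (L.map (f x) ys L.++ cartesianProductWith f xs ys)
      ≡⟨ length-++ (L.map (f x) ys) ⟩
    length (L.map (f x) ys) + length (cartesianProductWith f xs ys)
      ≡⟨ cong₂ _+_ (length-map (f x) ys) (length-cartesianProductWith f xs ys) ⟩
    length ys + length xs * length ys  ∎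

  _∈?_ : (v : F2^ n) (Ls : List (F2^ n)) → Dec (v ∈ Ls)
  v ∈? Ls = Any.any? (≡-dec Bool._≟_ v) Ls

  missing-point : (Ls : List (F2^ n)) → length Ls < 2 ^ n → Σ (F2^ n) (_∉ Ls)
  missing-point {n} Ls short with all? (λ i → enum n i ∈? Ls)
  ... | no notAll = let i , i∉Ls = ¬∀⟶∃¬ _ _ (λ i → enum n i ∈? Ls) notAll in enum n i , i∉Ls
  ... | yes all = contradiction (injective⇒≤ position-injective) (ℕP.<⇒≱ short)
    where
    -- every point has a position in Ls, and distinct points have distinct positions
    position : Fin (2 ^ n) → Fin (length Ls)
    position i = Any.index (all i)
    position-injective : ∀ {i j} → position i ≡ position j → i ≡ j
    position-injective {i} {j} eq = enum-injective n (begin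
      enum n i                  ≡⟨ lookup-index (all i) ⟩
      L.lookup Ls (position i)  ≡⟨ cong (L.lookup Ls) eq ⟩
      L.lookup Ls (position j)  ≡⟨ lookup-index (all j) ⟨
      enum n j                  ∎)

  -- Embedding lemma: if |U| 2ᵏ < 2ⁿ there are u₁,…,u_k ∈ 𝔽₂ⁿ such that only the
  -- trivial combination can lie in U.  Greedily pick u_{k+1} outside U + ⟨u₁,…,u_k⟩.
  avoiding-embedding : (U : List (F2^ n)) → ∀ k → length U * 2 ^ k < 2 ^ n →
    Σ (Vec (F2^ n) k) λ us → ∀ a → linMap us a ∈ U → a ≡ zeroV
  avoiding-embedding U zero _ = [] , λ { [] _ → refl }
  avoiding-embedding {n} U (suc k) small = y ∷ us , avoids′
    where
    smaller : length U * 2 ^ k < 2 ^ n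
    smaller = ℕP.≤-<-trans (ℕP.*-monoʳ-≤ (length U) (ℕP.^-monoʳ-≤ 2 (ℕP.n≤1+n k))) small
    previous = avoiding-embedding U k smaller
    us = proj₁ previous
    sumset = cartesianProductWith _⊕_ U (spanList us)
    fresh : Σ (F2^ n) (_∉ sumset)
    fresh = missing-point sumset (subst (_< 2 ^ n) size smaller)
      where
      size : length U * 2 ^ k ≡ length sumset
      size = sym (trans (length-cartesianProductWith _⊕_ U (spanList us))
                        (cong (length U *_) (length-spanList us)))
    y = proj₁ fresh
    avoids′ : ∀ a → linMap (y ∷ us) a ∈ U → a ≡ zeroV
    avoids′ (false ∷ a) a∈U = cong (false ∷_) (proj₂ previous a a∈U)
    avoids′ (true ∷ a) y+s∈U = ⊥-elim (proj₂ fresh (subst (_∈ sumset) (⊕-cancelʳ y s)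
      (∈-cartesianProductWith⁺ _⊕_ y+s∈U (∈-spanList us a))))
      where s = linMap us a

  uncoloured : {A B : Set} → (A → Maybe B) → List A → List A
  uncoloured c [] = []
  uncoloured c (x ∷ xs) with c x
  ... | nothing = x ∷ uncoloured c xs
  ... | just _  = uncoloured c xs

  length-uncoloured : {A B : Set} (c : A → Maybe B) (xs : List A) →
    length (uncoloured c xs) ≡ countNothing c xs
  length-uncoloured c [] = refl
  length-uncoloured c (x ∷ xs) with c x
  ... | nothing = cong suc (length-uncoloured c xs)
  ... | just _  = length-uncoloured c xs

  ∈-uncoloured : {A B : Set} (c : A → Maybe B) {xs : List A} {y : A} →
    y ∈ xs → c y ≡ nothing → y ∈ uncoloured c xs
  ∈-uncoloured c {x ∷ xs} (here refl) cy≡nothing with c x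
  ... | nothing = here refl
  ∈-uncoloured c {x ∷ xs} (there y∈xs) cy≡nothing with c x
  ... | nothing = there (∈-uncoloured c y∈xs cy≡nothing)
  ... | just _  = ∈-uncoloured c y∈xs cy≡nothing

  allVecs-complete : ∀ n (y : F2^ n) → y ∈ allVecs n
  allVecs-complete zero    []          = here refl
  allVecs-complete (suc n) (false ∷ y) = ∈-++⁺ˡ (∈-map⁺ (false ∷_) (allVecs-complete n y))
  allVecs-complete (suc n) (true ∷ y)  =
    ∈-++⁺ʳ (L.map (false ∷_) (allVecs n)) (∈-map⁺ (true ∷_) (allVecs-complete n y))

  puncture : {B : Set} → (F2^ n → Maybe B) → F2^ n → Maybe B
  puncture c y with ≡-dec Bool._≟_ y zeroV
  ... | yes _ = nothing
  ... | no  _ = c y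

  puncture-origin : {B : Set} (c : F2^ n → Maybe B) → puncture c zeroV ≡ nothing
  puncture-origin {n} c with ≡-dec Bool._≟_ (zeroV {n}) zeroV
  ... | yes _   = refl
  ... | no  0≢0 = contradiction refl 0≢0

  puncture-⊆ : {B : Set} (c : F2^ n → Maybe B) {y : F2^ n} {κ : B} →
    puncture c y ≡ just κ → c y ≡ just κ
  puncture-⊆ c {y} coloured with ≡-dec Bool._≟_ y zeroV
  ... | no _ = coloured

  puncture-uncoloured : {B : Set} (c : F2^ n → Maybe B) (y : F2^ n) →
    puncture c y ≡ nothing → y ∈ zeroV ∷ uncoloured c (allVecs n)
  puncture-uncoloured {n} c y uncol with ≡-dec Bool._≟_ y zeroV
  ... | yes refl = here refl
  ... | no  _    = there (∈-uncoloured c (allVecs-complete n y) uncol)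

  -- If 0 is uncoloured, a family whose nonempty sums are all coloured ρ is independent:
  -- a nontrivial vanishing combination would be a coloured 0.
  monochromatic⇒independent : {C : Set} (χ : F2^ n → Maybe C) {ρ : C} {xs : Vec (F2^ n) k} →
    χ zeroV ≡ nothing → MonochromaticSums χ ρ xs → LinIndep xs
  monochromatic⇒independent χ origin mono a a·xs≡0 with nonempty? a
  ... | yes a≢∅ = contradiction (trans (sym (mono a a≢∅)) (trans (cong χ a·xs≡0) origin)) λ ()
  ... | no  a≡∅ = Empty-unique a≡∅

  room-for-embedding : ∀ N n m → 2 + N ≤ n → m * suc (2 ^ suc N) ≤ 2 ^ n → suc m * 2 ^ N < 2 ^ n
  room-for-embedding N n m n≥2+N few =
    ℕP.*-cancelˡ-< 2 _ _ (subst₂ _<_ (sym (double m (2 ^ N))) twice2ⁿ sums<)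
    where
    double : ∀ m P → 2 * (suc m * P) ≡ 2 * P + m * (2 * P)
    double = solve-∀
    -- 2^(1+N) < 2ⁿ and m 2^(1+N) ≤ m (1 + 2^(1+N)) ≤ 2ⁿ
    sums< : 2 ^ suc N + m * 2 ^ suc N < 2 ^ n + 2 ^ n
    sums< = ℕP.+-mono-<-≤ (ℕP.^-monoʳ-< 2 ℕP.≤-refl n≥2+N)
                          (ℕP.≤-trans (ℕP.*-monoʳ-≤ m (ℕP.n≤1+n _)) few)
    twice2ⁿ : 2 ^ n + 2 ^ n ≡ 2 * 2 ^ n
    twice2ⁿ = cong (2 ^ n +_) (sym (ℕP.+-identityʳ (2 ^ n)))

  -- Transfer: when 2ⁿ is large compared with the number of uncoloured points,
  -- embed 𝔽₂ᴺ into 𝔽₂ⁿ avoiding them and 0, apply Folkman's theorem to the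
  -- pulled-back colouring and push the family forward.
  transfer : ∀ {r n T N} (d : ℕ) → FolkmanProperty r T N → sum (λ (_ : Fin (suc r)) → d) ≤ T →
    (c : F2^ n → Maybe (Fin (suc r))) → suc (countNothing c (allVecs n)) * 2 ^ N < 2 ^ n →
    Σ (Vec (F2^ n) d) λ xs → LinIndep xs × Σ (Fin (suc r)) λ k →
      (I : Subset d) → Nonempty I → c (linComb I xs) ≡ just k
  transfer {n = n} {N = N} d folkmanN total≤ c enough with avoiding-embedding U N roomForU
    where
    U = zeroV ∷ uncoloured c (allVecs n)
    roomForU : length U * 2 ^ N < 2 ^ n
    roomForU = subst (λ u → u * 2 ^ N < 2 ^ n) (sym (cong suc (length-uncoloured c (allVecs n)))) enough
  ... | us , avoids with folkmanN (λ _ → d) total≤ (puncture c ∘ linMap us) offZero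
    where
    offZero : ColouredOffZero (puncture c ∘ linMap us)
    offZero v uncol = avoids v (puncture-uncoloured c _ uncol)
  ... | ρ , xs , mono =
    map (linMap us) xs , monochromatic⇒independent (puncture c) (puncture-origin c) pushed ,
    ρ , λ I I≢∅ → puncture-⊆ c (pushed I I≢∅)
    where
    pushed : MonochromaticSums (puncture c) ρ (map (linMap us) xs)
    pushed = map-family (puncture c) us xs mono

open Ramsey

open import Defs
open import Data.Nat using (ℕ; _≥_)
open import Data.Vec using (Vec)
open import Data.Fin using (Fin)
open import Data.Fin.Subset using (Subset; Nonempty)
open import Data.Maybe using (Maybe; just)
open import Data.Rational using (ℚ; _≤_; _<_; 0ℚ)
open import Data.Product using (Σ; _×_; _,_)
open import Relation.Binary.PropositionalEquality using (_≡_)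
open import Data.Nat using (zero; suc; _+_; _*_; _^_)
import Data.Nat as ℕ
import Data.Nat.Properties as ℕP
open import Algebra.Definitions.RawMonoid ℕ.+-0-rawMonoid using (sum)
import Data.Integer as ℤ
import Data.Integer.Properties as ℤP
open import Data.Rational using (mkℚ)
import Data.Rational as ℚ
import Data.Rational.Properties as ℚP
import Data.Rational.Unnormalised as ℚᵘ
import Data.Rational.Unnormalised.Properties as ℚᵘP
open import Data.Nat.Coprimality using (1-coprimeTo)
import Data.Nat.Coprimality as Coprime
open import Relation.Binary.PropositionalEquality using (cong; trans; sym; subst₂)

-- The rational 1/(1+q).
unitFraction : ℕ → ℚ
unitFraction q = mkℚ (ℤ.+ 1) q (1-coprimeTo (suc q))

-- ℕtoℚ k in normal form, where numerator and denominator are visible.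
ℕtoℚ-mkℚ : ∀ k → ℕtoℚ k ≡ mkℚ (ℤ.+ k) 0 (Coprime.sym (1-coprimeTo k))
ℕtoℚ-mkℚ k = ℚP.normalize-coprime (Coprime.sym (1-coprimeTo k))

ℕtoℚ-nonNegative : ∀ k → ℚ.NonNegative (ℕtoℚ k)
ℕtoℚ-nonNegative k rewrite ℕtoℚ-mkℚ k = _

-- m ≤ P/(1+q) in ℚ means m (1+q) ≤ P in ℕ: cross-multiply in the
-- unnormalised rationals and read the integer inequality in ℕ.
unitFraction-bound : ∀ q m P → ℕtoℚ m ≤ unitFraction q ℚ.* ℕtoℚ P → m * suc q ℕ.≤ P
unitFraction-bound q m P m≤P/q rewrite ℕtoℚ-mkℚ m | ℕtoℚ-mkℚ P
  with ℚᵘP.≤-respʳ-≃ (ℚP.toℚᵘ-homo-* (unitFraction q) (mkℚ (ℤ.+ P) 0 (Coprime.sym (1-coprimeTo P))))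
                     (ℚP.toℚᵘ-mono-≤ m≤P/q)
... | ℚᵘ.*≤* cross =
  subst₂ ℕ._≤_ (cong (λ z → m * suc z) (ℕP.*-identityʳ q)) (ℕP.+-identityʳ P)
    (ℤP.drop‿+≤+ (subst₂ ℤ._≤_ (sym (ℤP.pos-* m _))
                              (trans (ℤP.*-identityʳ _) (ℤP.+◃n≡+n (P + 0))) cross))

few-uncoloured : ∀ {n r} N (η : ℚ) (c : F2^ n → Maybe (Fin r)) → n ≥ 2 + N →
  η ≤ unitFraction (2 ^ suc N) → AlmostColouring n r η c →
  suc (countNothing c (allVecs n)) * 2 ^ N ℕ.< 2 ^ n
few-uncoloured {n} N η c n≥2+N η≤ almost =
  room-for-embedding N n m n≥2+N
    (unitFraction-bound (2 ^ suc N) m (2 ^ n) (ℚP.≤-trans almost η2ⁿ≤))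
  where
  m = countNothing c (allVecs n)
  η2ⁿ≤ : η ℚ.* ℕtoℚ (2 ^ n) ≤ unitFraction (2 ^ suc N) ℚ.* ℕtoℚ (2 ^ n)
  η2ⁿ≤ = ℚP.*-monoʳ-≤-nonNeg (ℕtoℚ (2 ^ n)) {{ℕtoℚ-nonNegative (2 ^ n)}} η≤

-- Proposition 3.1, with η(r,d) = 1/(1+2^(1+N)) and n₀ = 2+N, where N is the
-- dimension given by Folkman's theorem for r colours and all demands equal to d.
proposition3p1 : (r d : ℕ) → r ≥ 1 → d ≥ 1 →
    Σ ℚ λ η₀ → 0ℚ < η₀ × Σ ℕ λ n₀ →
      (n : ℕ) → n ≥ n₀ → (η : ℚ) → 0ℚ ≤ η → η ≤ η₀ →
      (c : F2^ n → Maybe (Fin r)) → AlmostColouring n r η c →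
      Σ (Vec (F2^ n) d) λ xs → LinIndep xs × Σ (Fin r) λ k →
        (I : Subset d) → Nonempty I → c (linComb I xs) ≡ just k
proposition3p1 zero    d () _
proposition3p1 (suc r) d _ _ with folkman r (sum (λ (_ : Fin (suc r)) → d))
... | N , folkmanN = unitFraction (2 ^ suc N) , ℚP.positive⁻¹ _ , 2 + N ,
  λ n n≥2+N η _ η≤ c almost →
    transfer d folkmanN ℕP.≤-refl c (few-uncoloured N η c n≥2+N η≤ almost)
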